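{- Let $k\ge 3$ be fixed, and let $\{\mathcal{H}_n\}_n$ be a sequence of $k$-uniform hypergraphs, $\mathcal{H}_n$ on $[n]$, such that $\deg_{\mathcal{H}_n}(B)=\Theta(n^{k-2})$ for all $n$ and all $B\in\binom{[n]}{2}$ (uniformly in $B$). Let $\mathcal{P}$ denote the property ``every pair of distinct vertices is joined by at least one edge''. Then \[ \lim_{n\to +\infty} \, \mathbb{P}(\mathbb{G}(n,1\, ; \,\mathcal{H}_n) \in \mathcal{P}) = 1 . \]
   Context: A hypergraph on $[n]=\{1,\dots,n\}$ is a finite collection of subsets of $[n]$, with repetitions allowed; it is $k$-uniform if all members have exactly $k$ elements. $\binom{[n]}{2}$ is the set of 2-element subsets of $[n]$. For $B\subset[n]$, $\deg_{\mathcal{H}}(B)$ is the number of members $H\in\mathcal{H}$ (with multiplicity) with $B\subset H$. $a_n=\Theta(b_n)$ means there are constants $c,C>0$ and $n_0$ with $cb_n\le a_n\le Cb_n$ for $n\ge n_0$. For $p\in[0,1]$, the random multigraph $\mathbb{G}(n,p\,;\,\mathcal{H})$ is generated as follows: start with the empty graph on vertex set $[n]$; for every member $H\in\mathcal{H}$ (each occurrence separately), choose a 2-element subset $\{i,j\}\subset H$ uniformly at random and then add an edge between $i$ and $j$ with probability $p$; all choices and coin flips are mutually independent. -}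

module Defs where

open import Data.Nat as ℕ using (ℕ; zero; suc)
open import Data.Bool using (Bool; true; false; _∧_; _∨_; if_then_else_)
open import Data.Fin using (Fin; _<_)
open import Data.Fin.Properties using (_<?_)
open import Data.Fin.Subset using (Subset; ∣_∣)
open import Data.Vec using (lookup)
open import Data.List using (List; []; _∷_; filter; length; allFin; concatMap; map; _++_)
open import Data.Bool.ListAction using (any; all)
open import Data.Product using (_×_; _,_; proj₁; proj₂)
open import Data.Integer using (+_)
open import Data.Rational using (ℚ; _/_; _*_; _+_; _-_; 0ℚ; 1ℚ)
open import Relation.Nullary.Decidable using (⌊_⌋)
open import Data.List.Relation.Unary.All using (All)
open import Relation.Binary.PropositionalEquality using (_≡_)

-- A hypergraph on [n] = Fin n: a finite list of subsets (repetitions allowed).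
Hypergraph : ℕ → Set
Hypergraph n = List (Subset n)

Uniform : ∀ {n} → ℕ → Hypergraph n → Set
Uniform k H = All (λ S → ∣ S ∣ ≡ k) H

mem : ∀ {n} → Fin n → Subset n → Bool
mem i S = lookup S i

deg : ∀ {n} → Hypergraph n → Fin n → Fin n → ℕ
deg H i j = length (filter (λ S → Data.Bool._≟_ (mem i S ∧ mem j S) true) H)
  where import Data.Bool

-- all ordered pairs (i , j) of Fin n with i < j (one per 2-subset {i,j})
allPairs : (n : ℕ) → List (Fin n × Fin n)
allPairs n = concatMap (λ i → map (λ j → (i , j)) (filter (λ j → i <? j) (allFin n))) (allFin n)

pairsIn : ∀ {n} → Subset n → List (Fin n × Fin n)
pairsIn {n} S = filter (λ p → Data.Bool._≟_ (mem (proj₁ p) S ∧ mem (proj₂ p) S) true) (allPairs n)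
  where import Data.Bool

Multigraph : ℕ → Set
Multigraph n = List (Fin n × Fin n)

Dist : ℕ → Set
Dist n = List (ℚ × Multigraph n)

-- One step for a member S: choose a pair of S uniformly (prob 1/m each, m = #pairs),
-- then add the edge with probability p.  (If S has no pair, nothing happens.)
stepOutcomes : ∀ {n} → ℚ → Subset n → List (ℚ × List (Fin n × Fin n))
stepOutcomes {n} p S with length (pairsIn S)
... | zero = (1ℚ , []) ∷ []
... | suc m = concatMap (λ e → ((+ 1 / suc m) * p , e ∷ []) ∷ ((+ 1 / suc m) * (1ℚ - p) , []) ∷ []) (pairsIn S)

-- The law of 𝔾(n, p ; H): all choices/coins independent (product distribution).
Gdist : ∀ {n} → ℚ → Hypergraph n → Dist n
Gdist p [] = (1ℚ , []) ∷ []
Gdist p (S ∷ H) =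
  concatMap (λ a → map (λ b → (proj₁ a * proj₁ b , proj₂ a ++ proj₂ b)) (Gdist p H)) (stepOutcomes p S)

Prob : ∀ {n} → ℚ → Hypergraph n → (Multigraph n → Bool) → ℚ
Prob p H P = go (Gdist p H)
  where
  go : _ → ℚ
  go [] = 0ℚ
  go ((w , g) ∷ rest) = (if P g then w else 0ℚ) + go rest

joined : ∀ {n} → Multigraph n → Fin n → Fin n → Bool
joined {n} G i j = any (λ e → (eqF (proj₁ e) i ∧ eqF (proj₂ e) j) ∨ (eqF (proj₁ e) j ∧ eqF (proj₂ e) i)) G
  where
  import Data.Bool
  eqF : Fin n → Fin n → Bool
  eqF a b = ⌊ Data.Fin._≟_ a b ⌋

Complete : ∀ {n} → Multigraph n → Bool
Complete {n} G = all (λ p → joined G (proj₁ p) (proj₂ p)) (allPairs n)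

{-# OPTIONS --safe #-}

-- With p = 1 every member S of H joins one of its at most k² pairs, chosen uniformly, so a fixed pair
-- {i,j} is missed by all deg(i,j) members containing it, which act independently, with probability at
-- most (1 - 1/(k²+1))^deg(i,j). For k ≥ 3 the degree bound gives deg(i,j) ≥ c n^(k-2) ≥ n/b, and an
-- exponential in n/b beats n³, so each pair is missed with probability O(n⁻³). A union bound over the
-- fewer than n² pairs bounds the probability that 𝔾(n,1;H) is not complete by O(1/n).

module Submission where

open import Defs
open import Data.Nat using (ℕ; _∸_; _≥_)
open import Data.Fin using (Fin; _<_)
open import Data.Product using (∃; _×_)
open import Data.Integer using (+_)
open import Data.Rational using (ℚ; _/_; _*_; _-_; _≤_; 0ℚ; 1ℚ; ∣_∣) renaming (_<_ to _<ℚ_)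

open import Algebra.Definitions.RawSemiring Data.Rational.+-*-rawSemiring using (_^_)
open import Data.Bool using (Bool; true; false; not; _∧_; _∨_; if_then_else_)
import Data.Bool.Properties as Bool
open import Data.Bool.ListAction using (all; any)
open import Data.Empty using (⊥-elim)
import Data.Fin.Base as Fin
import Data.Fin.Properties as Fin
open import Data.Fin.Subset using (Subset)
import Data.Fin.Subset as Subset
open import Data.Vec using ([]; _∷_)
open import Data.Integer.Base as ℤ using (+[1+_]; -[1+_])
import Data.Integer.Properties as ℤ
open import Data.List using (List; []; _∷_; _++_; map; concatMap; length; filter; allFin; tabulate)
import Data.List.Properties as List
open import Data.List.Membership.Propositional using (_∈_; lose)
open import Data.List.Membership.Propositional.Properties
  using (∈-allFin; ∈-map⁺; ∈-map⁻; ∈-filter⁺; ∈-filter⁻; ∈-concatMap⁺; ∈-concatMap⁻; ∈-length)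
import Data.List.Relation.Binary.Sublist.Propositional.Properties as Sublist
open import Data.List.Relation.Unary.All as All using (All; []; _∷_)
open import Data.List.Relation.Unary.All.Properties using (++⁺)
open import Data.List.Relation.Unary.Any using (here; there; satisfied)
open import Data.Nat.Base as ℕ using (zero; suc; z≤n; s≤s)
import Data.Nat.Properties as ℕ
open import Data.Nat.Solver using () renaming (module +-*-Solver to ℕ-Solver)
open import Data.Product using (_,_; proj₁; proj₂)
open import Data.Rational using (mkℚ; *<*; _+_; -_; toℚᵘ; nonNegative; positive)
import Data.Rational.Properties as ℚ
open import Data.Rational.Solver using (module +-*-Solver)
open import Data.Rational.Unnormalised as ℚᵘ using (mkℚᵘ; *≡*)
import Data.Rational.Unnormalised.Properties as ℚᵘ
open import Function using (_∘_; id)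
open import Relation.Binary.PropositionalEquality
open import Relation.Nullary.Decidable using (dec-true; isYes≗does)
open import Relation.Unary using (Decidable)

private
  variable
    A B C : Set

-- Rational arithmetic

*-nonNeg : ∀ {p q} → 0ℚ ≤ p → 0ℚ ≤ q → 0ℚ ≤ p * q
*-nonNeg {p} {q} 0≤p 0≤q =
  ℚ.nonNegative⁻¹ (p * q) {{ℚ.nonNeg*nonNeg⇒nonNeg p {{nonNegative 0≤p}} q {{nonNegative 0≤q}}}}

*-mono-≤-nonNeg : ∀ {a b c d} → 0ℚ ≤ a → 0ℚ ≤ d → a ≤ b → c ≤ d → a * c ≤ b * d
*-mono-≤-nonNeg {a} {b} {c} {d} 0≤a 0≤d a≤b c≤d =
  ℚ.≤-trans (ℚ.*-monoˡ-≤-nonNeg a {{nonNegative 0≤a}} c≤d) (ℚ.*-monoʳ-≤-nonNeg d {{nonNegative 0≤d}} a≤b)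

fromℕ : ℕ → ℚ
fromℕ n = + n / 1

-- i / suc d is fromℚᵘ (mkℚᵘ i d) by definition, so identities between such fractions reduce to
-- integer cross-multiplication.
toℚᵘ-/ : ∀ i d → toℚᵘ (i / suc d) ℚᵘ.≃ mkℚᵘ i d
toℚᵘ-/ i d = ℚ.toℚᵘ-fromℚᵘ (mkℚᵘ i d)

fromℕ-suc : ∀ n → fromℕ (suc n) ≡ 1ℚ + fromℕ n
fromℕ-suc n = ℚ.toℚᵘ-injective (begin
  toℚᵘ (fromℕ (suc n))
    ≈⟨ toℚᵘ-/ (+ suc n) 0 ⟩
  mkℚᵘ (+ suc n) 0
    ≈⟨ *≡* (cong (ℤ._* + 1) (cong (ℤ._+_ (+ 1)) (ℤ.*-identityʳ (+ n)))) ⟨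
  toℚᵘ 1ℚ ℚᵘ.+ mkℚᵘ (+ n) 0
    ≈⟨ ℚᵘ.+-congʳ (toℚᵘ 1ℚ) (toℚᵘ-/ (+ n) 0) ⟨
  toℚᵘ 1ℚ ℚᵘ.+ toℚᵘ (fromℕ n)
    ≈⟨ ℚ.toℚᵘ-homo-+ 1ℚ (fromℕ n) ⟨
  toℚᵘ (1ℚ + fromℕ n)
    ∎)
  where open ℚᵘ.≃-Reasoning

fromℕ-homo-+ : ∀ m n → fromℕ (m ℕ.+ n) ≡ fromℕ m + fromℕ n
fromℕ-homo-+ zero    n = sym (ℚ.+-identityˡ (fromℕ n))
fromℕ-homo-+ (suc m) n = begin
  fromℕ (suc (m ℕ.+ n))        ≡⟨ fromℕ-suc (m ℕ.+ n) ⟩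
  1ℚ + fromℕ (m ℕ.+ n)         ≡⟨ cong (_+_ 1ℚ) (fromℕ-homo-+ m n) ⟩
  1ℚ + (fromℕ m + fromℕ n)     ≡⟨ ℚ.+-assoc 1ℚ (fromℕ m) (fromℕ n) ⟨
  1ℚ + fromℕ m + fromℕ n       ≡⟨ cong (_+ fromℕ n) (fromℕ-suc m) ⟨
  fromℕ (suc m) + fromℕ n      ∎
  where open ≡-Reasoning

fromℕ-homo-* : ∀ m n → fromℕ (m ℕ.* n) ≡ fromℕ m * fromℕ n
fromℕ-homo-* zero    n = sym (ℚ.*-zeroˡ (fromℕ n))
fromℕ-homo-* (suc m) n = begin
  fromℕ (n ℕ.+ m ℕ.* n)              ≡⟨ fromℕ-homo-+ n (m ℕ.* n) ⟩
  fromℕ n + fromℕ (m ℕ.* n)          ≡⟨ cong (_+_ (fromℕ n)) (fromℕ-homo-* m n) ⟩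
  fromℕ n + fromℕ m * fromℕ n        ≡⟨ solve 2 (λ x y → x :+ y :* x := (con 1ℚ :+ y) :* x) refl (fromℕ n) (fromℕ m) ⟩
  (1ℚ + fromℕ m) * fromℕ n           ≡⟨ cong (_* fromℕ n) (fromℕ-suc m) ⟨
  fromℕ (suc m) * fromℕ n            ∎
  where open ≡-Reasoning; open +-*-Solver

fromℕ-nonNeg : ∀ n → 0ℚ ≤ fromℕ n
fromℕ-nonNeg n = ℚ.nonNegative⁻¹ (fromℕ n) {{ℚ.normalize-nonNeg n 1}}

fromℕ-mono-≤ : ∀ {m n} → m ℕ.≤ n → fromℕ m ≤ fromℕ n
fromℕ-mono-≤ {n = n} z≤n = fromℕ-nonNeg n
fromℕ-mono-≤ {suc m} {suc n} (s≤s m≤n) =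
  subst₂ _≤_ (sym (fromℕ-suc m)) (sym (fromℕ-suc n)) (ℚ.+-monoʳ-≤ 1ℚ (fromℕ-mono-≤ m≤n))

fromℕ-mono-< : ∀ {m n} → m ℕ.< n → fromℕ m <ℚ fromℕ n
fromℕ-mono-< {m} m<n = ℚ.<-≤-trans m<1+m (fromℕ-mono-≤ m<n)
  where
  m<1+m : fromℕ m <ℚ fromℕ (suc m)
  m<1+m = subst₂ _<ℚ_ (ℚ.+-identityˡ (fromℕ m)) (sym (fromℕ-suc m)) (ℚ.+-monoˡ-< (fromℕ m) (ℚ.positive⁻¹ 1ℚ))

fromℕ-cancel-≤ : ∀ {m n} → fromℕ m ≤ fromℕ n → m ℕ.≤ n
fromℕ-cancel-≤ fm≤fn = ℕ.≮⇒≥ λ n<m → ℚ.<-irrefl refl (ℚ.<-≤-trans (fromℕ-mono-< n<m) fm≤fn)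

positive⇒∃1≤*fromℕ : ∀ {p} → 0ℚ <ℚ p → ∃ λ b → 1ℚ ≤ p * fromℕ b
positive⇒∃1≤*fromℕ {p@(mkℚ +[1+ a ] d _)} _ = suc d , subst (1ℚ ≤_) (sym p*[1+d]≡1+a) (fromℕ-mono-≤ {1} {suc a} (s≤s z≤n))
  where
  p*[1+d]≡1+a : p * fromℕ (suc d) ≡ fromℕ (suc a)
  p*[1+d]≡1+a = ℚ.toℚᵘ-injective (ℚᵘ.≃-trans (ℚ.toℚᵘ-homo-* p (fromℕ (suc d)))
    (ℚᵘ.≃-trans (ℚᵘ.*-congˡ {mkℚᵘ +[1+ a ] d} (toℚᵘ-/ (+ suc d) 0))
    (ℚᵘ.≃-sym (ℚᵘ.≃-trans (toℚᵘ-/ (+ suc a) 0) (*≡* identity)))))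
    where
    identity : + suc a ℤ.* + suc (d ℕ.* 1) ≡ (+ suc a ℤ.* + suc d) ℤ.* + 1
    identity = trans (cong (λ m → + suc a ℤ.* + suc m) (ℕ.*-identityʳ d)) (sym (ℤ.*-identityʳ _))
positive⇒∃1≤*fromℕ {mkℚ (+ zero)   _ _} (*<* (ℤ.+<+ ()))
positive⇒∃1≤*fromℕ {mkℚ -[1+ _ ] _ _} (*<* ())

1≤c*b∧c*x≤y⇒x≤y*b : ∀ {c b x y} → 1ℚ ≤ c * fromℕ b → c * fromℕ x ≤ fromℕ y → x ℕ.≤ y ℕ.* b
1≤c*b∧c*x≤y⇒x≤y*b {c} {b} {x} {y} 1≤cb cx≤y = fromℕ-cancel-≤ (begin
  fromℕ x                      ≡⟨ ℚ.*-identityˡ (fromℕ x) ⟨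
  1ℚ * fromℕ x                 ≤⟨ ℚ.*-monoʳ-≤-nonNeg (fromℕ x) {{nonNegative (fromℕ-nonNeg x)}} 1≤cb ⟩
  c * fromℕ b * fromℕ x        ≡⟨ solve 3 (λ c b x → c :* b :* x := c :* x :* b) refl c (fromℕ b) (fromℕ x) ⟩
  c * fromℕ x * fromℕ b        ≤⟨ ℚ.*-monoʳ-≤-nonNeg (fromℕ b) {{nonNegative (fromℕ-nonNeg b)}} cx≤y ⟩
  fromℕ y * fromℕ b            ≡⟨ fromℕ-homo-* y b ⟨
  fromℕ (y ℕ.* b)              ∎)
  where open ℚ.≤-Reasoning; open +-*-Solver

1/suc : ℕ → ℚ
1/suc m = + 1 / suc m

1/suc-nonNeg : ∀ m → 0ℚ ≤ 1/suc m
1/suc-nonNeg m = ℚ.nonNegative⁻¹ (1/suc m) {{ℚ.normalize-nonNeg 1 (suc m)}}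

1/suc-inverse : ∀ m → 1/suc m * fromℕ (suc m) ≡ 1ℚ
1/suc-inverse m = ℚ.toℚᵘ-injective (ℚᵘ.≃-trans (ℚ.toℚᵘ-homo-* (1/suc m) (fromℕ (suc m)))
  (ℚᵘ.≃-trans (ℚᵘ.*-cong (toℚᵘ-/ (+ 1) m) (toℚᵘ-/ (+ suc m) 0)) (*≡* identity)))
  where
  identity : (+ 1 ℤ.* + suc m) ℤ.* + 1 ≡ + 1 ℤ.* + suc (m ℕ.* 1)
  identity = trans (ℤ.*-identityʳ _) (trans (ℤ.*-identityˡ _)
    (sym (trans (ℤ.*-identityˡ _) (cong (λ k → + suc k) (ℕ.*-identityʳ m)))))

1/suc-antitone : ∀ {m L} → m ℕ.≤ L → 1/suc L ≤ 1/suc m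
1/suc-antitone {m} {L} m≤L = ℚ.toℚᵘ-cancel-≤
  (ℚᵘ.≤-respˡ-≃ (ℚᵘ.≃-sym (toℚᵘ-/ (+ 1) L)) (ℚᵘ.≤-respʳ-≃ (ℚᵘ.≃-sym (toℚᵘ-/ (+ 1) m)) (ℚᵘ.*≤* cross)))
  where
  cross : + 1 ℤ.* + suc m ℤ.≤ + 1 ℤ.* + suc L
  cross = subst₂ ℤ._≤_ (sym (ℤ.*-identityˡ (+ suc m))) (sym (ℤ.*-identityˡ (+ suc L))) (ℤ.+≤+ (s≤s m≤L))

missBound : ℕ → ℚ
missBound L = 1ℚ - 1/suc L

missBound-nonNeg : ∀ L → 0ℚ ≤ missBound L
missBound-nonNeg L = ℚ.+-monoʳ-≤ 1ℚ (ℚ.neg-antimono-≤ (1/suc-antitone {0} {L} z≤n))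

missBound-mono : ∀ {m L} → m ℕ.≤ L → missBound m ≤ missBound L
missBound-mono m≤L = ℚ.+-monoʳ-≤ 1ℚ (ℚ.neg-antimono-≤ (1/suc-antitone m≤L))

1/suc*fromℕ≡missBound : ∀ m → 1/suc m * fromℕ m ≡ missBound m
1/suc*fromℕ≡missBound m = begin
  1/suc m * fromℕ m
    ≡⟨ solve 2 (λ u x → u :* x := u :* (con 1ℚ :+ x) :- u) refl (1/suc m) (fromℕ m) ⟩
  1/suc m * (1ℚ + fromℕ m) - 1/suc m
    ≡⟨ cong (λ x → 1/suc m * x - 1/suc m) (fromℕ-suc m) ⟨
  1/suc m * fromℕ (suc m) - 1/suc m
    ≡⟨ cong (_- 1/suc m) (1/suc-inverse m) ⟩
  missBound m
    ∎
  where open ≡-Reasoning; open +-*-Solver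

missBound*fromℕ-suc : ∀ L → missBound L * fromℕ (suc L) ≡ fromℕ L
missBound*fromℕ-suc L = begin
  (1ℚ - 1/suc L) * fromℕ (suc L)
    ≡⟨ solve 2 (λ u x → (con 1ℚ :- u) :* x := x :- u :* x) refl (1/suc L) (fromℕ (suc L)) ⟩
  fromℕ (suc L) - 1/suc L * fromℕ (suc L)
    ≡⟨ cong₂ _-_ (fromℕ-suc L) (1/suc-inverse L) ⟩
  1ℚ + fromℕ L - 1ℚ
    ≡⟨ solve 1 (λ x → con 1ℚ :+ x :- con 1ℚ := x) refl (fromℕ L) ⟩
  fromℕ L
    ∎
  where open ≡-Reasoning; open +-*-Solver

^-nonNeg : ∀ {x} → 0ℚ ≤ x → ∀ d → 0ℚ ≤ x ^ d
^-nonNeg 0≤x zero    = fromℕ-nonNeg 1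
^-nonNeg 0≤x (suc d) = *-nonNeg 0≤x (^-nonNeg 0≤x d)

-- Exponential decay beats cubic growth

n≤n^e : ∀ n {e} → 1 ℕ.≤ e → n ℕ.≤ n ℕ.^ e
n≤n^e zero        1≤e = z≤n
n≤n^e n@(suc _) {e} 1≤e = subst (ℕ._≤ n ℕ.^ e) (ℕ.^-identityʳ n) (ℕ.^-monoʳ-≤ n 1≤e)

-- L ((s+1)³ - s³) ≤ 7 L s², whence the threshold 7L.
L*[1+s]³≤[1+L]*s³ : ∀ L s → 7 ℕ.* L ℕ.< s → L ℕ.* suc s ℕ.^ 3 ℕ.≤ suc L ℕ.* s ℕ.^ 3
L*[1+s]³≤[1+L]*s³ L s 7L<s = begin
  L ℕ.* suc s ℕ.^ 3
    ≡⟨ solve 2 (λ L s → L :* (con 1 :+ s) :^ 3 := L :* s :^ 3 :+ (con 3 :* (L :* s :* s) :+ con 3 :* (L :* s) :+ L)) refl L s ⟩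
  L ℕ.* s ℕ.^ 3 ℕ.+ (3 ℕ.* (L ℕ.* s ℕ.* s) ℕ.+ 3 ℕ.* (L ℕ.* s) ℕ.+ L)
    ≤⟨ ℕ.+-monoʳ-≤ (L ℕ.* s ℕ.^ 3) lower-terms ⟩
  L ℕ.* s ℕ.^ 3 ℕ.+ s ℕ.^ 3
    ≡⟨ solve 2 (λ L s → L :* s :^ 3 :+ s :^ 3 := (con 1 :+ L) :* s :^ 3) refl L s ⟩
  suc L ℕ.* s ℕ.^ 3
    ∎
  where
  open ℕ.≤-Reasoning
  open ℕ-Solver
  ≤*s : ∀ x → x ℕ.≤ x ℕ.* s
  ≤*s x = subst (ℕ._≤ x ℕ.* s) (ℕ.*-identityʳ x) (ℕ.*-monoʳ-≤ x (ℕ.≤-trans (s≤s z≤n) 7L<s))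
  lower-terms : 3 ℕ.* (L ℕ.* s ℕ.* s) ℕ.+ 3 ℕ.* (L ℕ.* s) ℕ.+ L ℕ.≤ s ℕ.^ 3
  lower-terms = begin
    3 ℕ.* (L ℕ.* s ℕ.* s) ℕ.+ 3 ℕ.* (L ℕ.* s) ℕ.+ L
      ≤⟨ ℕ.+-mono-≤ (ℕ.+-monoʳ-≤ (3 ℕ.* (L ℕ.* s ℕ.* s)) (ℕ.*-monoʳ-≤ 3 (≤*s (L ℕ.* s))))
                    (ℕ.≤-trans (≤*s L) (≤*s (L ℕ.* s))) ⟩
    3 ℕ.* (L ℕ.* s ℕ.* s) ℕ.+ 3 ℕ.* (L ℕ.* s ℕ.* s) ℕ.+ L ℕ.* s ℕ.* s
      ≡⟨ solve 2 (λ L s → con 3 :* (L :* s :* s) :+ con 3 :* (L :* s :* s) :+ L :* s :* s := con 7 :* L :* s :* s) refl L s ⟩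
    7 ℕ.* L ℕ.* s ℕ.* s
      ≤⟨ ℕ.*-monoˡ-≤ s (ℕ.*-monoˡ-≤ s (ℕ.<⇒≤ 7L<s)) ⟩
    s ℕ.* s ℕ.* s
      ≡⟨ solve 1 (λ s → s :* s :* s := s :^ 3) refl s ⟩
    s ℕ.^ 3
      ∎

cubic≤exponential : ∀ L t → L ℕ.^ t ℕ.* (t ℕ.+ suc (7 ℕ.* L)) ℕ.^ 3 ℕ.≤ suc L ℕ.^ t ℕ.* suc (7 ℕ.* L) ℕ.^ 3
cubic≤exponential L zero    = ℕ.≤-refl
cubic≤exponential L (suc t) = begin
  L ℕ.* L ℕ.^ t ℕ.* suc (t ℕ.+ a) ℕ.^ 3
    ≡⟨ solve 3 (λ L p x → L :* p :* x := p :* (L :* x)) refl L (L ℕ.^ t) (suc (t ℕ.+ a) ℕ.^ 3) ⟩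
  L ℕ.^ t ℕ.* (L ℕ.* suc (t ℕ.+ a) ℕ.^ 3)
    ≤⟨ ℕ.*-monoʳ-≤ (L ℕ.^ t) (L*[1+s]³≤[1+L]*s³ L (t ℕ.+ a) (ℕ.m≤n+m a t)) ⟩
  L ℕ.^ t ℕ.* (suc L ℕ.* (t ℕ.+ a) ℕ.^ 3)
    ≡⟨ solve 3 (λ L p x → p :* (L :* x) := L :* (p :* x)) refl (suc L) (L ℕ.^ t) ((t ℕ.+ a) ℕ.^ 3) ⟩
  suc L ℕ.* (L ℕ.^ t ℕ.* (t ℕ.+ a) ℕ.^ 3)
    ≤⟨ ℕ.*-monoʳ-≤ (suc L) (cubic≤exponential L t) ⟩
  suc L ℕ.* (suc L ℕ.^ t ℕ.* a ℕ.^ 3)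
    ≡⟨ ℕ.*-assoc (suc L) (suc L ℕ.^ t) (a ℕ.^ 3) ⟨
  suc L ℕ.* suc L ℕ.^ t ℕ.* a ℕ.^ 3
    ∎
  where
  open ℕ.≤-Reasoning
  open ℕ-Solver
  a : ℕ
  a = suc (7 ℕ.* L)

decayConstant : ℕ → ℕ → ℕ
decayConstant L b = suc (7 ℕ.* L) ℕ.^ 3 ℕ.* b ℕ.^ 3

L^d*n³≤[1+L]^d*decayConstant : ∀ L b d n → n ℕ.≤ d ℕ.* b → L ℕ.^ d ℕ.* n ℕ.^ 3 ℕ.≤ suc L ℕ.^ d ℕ.* decayConstant L b
L^d*n³≤[1+L]^d*decayConstant L b d n n≤db = begin
  L ℕ.^ d ℕ.* n ℕ.^ 3
    ≤⟨ ℕ.*-monoʳ-≤ (L ℕ.^ d) (ℕ.^-monoˡ-≤ 3 n≤db) ⟩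
  L ℕ.^ d ℕ.* (d ℕ.* b) ℕ.^ 3
    ≡⟨ solve 3 (λ p d b → p :* (d :* b) :^ 3 := p :* d :^ 3 :* b :^ 3) refl (L ℕ.^ d) d b ⟩
  L ℕ.^ d ℕ.* d ℕ.^ 3 ℕ.* b ℕ.^ 3
    ≤⟨ ℕ.*-monoˡ-≤ (b ℕ.^ 3) (ℕ.*-monoʳ-≤ (L ℕ.^ d) (ℕ.^-monoˡ-≤ 3 (ℕ.m≤m+n d a))) ⟩
  L ℕ.^ d ℕ.* (d ℕ.+ a) ℕ.^ 3 ℕ.* b ℕ.^ 3
    ≤⟨ ℕ.*-monoˡ-≤ (b ℕ.^ 3) (cubic≤exponential L d) ⟩
  suc L ℕ.^ d ℕ.* a ℕ.^ 3 ℕ.* b ℕ.^ 3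
    ≡⟨ ℕ.*-assoc (suc L ℕ.^ d) (a ℕ.^ 3) (b ℕ.^ 3) ⟩
  suc L ℕ.^ d ℕ.* decayConstant L b
    ∎
  where
  open ℕ.≤-Reasoning
  open ℕ-Solver
  a : ℕ
  a = suc (7 ℕ.* L)

missBound^d*[1+L]^d≡L^d : ∀ L d → missBound L ^ d * fromℕ (suc L ℕ.^ d) ≡ fromℕ (L ℕ.^ d)
missBound^d*[1+L]^d≡L^d L zero    = ℚ.*-identityˡ (fromℕ 1)
missBound^d*[1+L]^d≡L^d L (suc d) = begin
  q * q ^ d * fromℕ (suc L ℕ.* suc L ℕ.^ d)
    ≡⟨ cong (q * q ^ d *_) (fromℕ-homo-* (suc L) (suc L ℕ.^ d)) ⟩
  q * q ^ d * (fromℕ (suc L) * fromℕ (suc L ℕ.^ d))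
    ≡⟨ solve 4 (λ q p a b → q :* p :* (a :* b) := (q :* a) :* (p :* b)) refl q (q ^ d) (fromℕ (suc L)) (fromℕ (suc L ℕ.^ d)) ⟩
  (q * fromℕ (suc L)) * (q ^ d * fromℕ (suc L ℕ.^ d))
    ≡⟨ cong₂ _*_ (missBound*fromℕ-suc L) (missBound^d*[1+L]^d≡L^d L d) ⟩
  fromℕ L * fromℕ (L ℕ.^ d)
    ≡⟨ fromℕ-homo-* L (L ℕ.^ d) ⟨
  fromℕ (L ℕ.* L ℕ.^ d)
    ∎
  where
  open ≡-Reasoning
  open +-*-Solver
  q : ℚ
  q = missBound L

missBound^d*n³≤decayConstant : ∀ L b d n → n ℕ.≤ d ℕ.* b → missBound L ^ d * fromℕ (n ℕ.^ 3) ≤ fromℕ (decayConstant L b)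
missBound^d*n³≤decayConstant L b d n n≤db = ℚ.*-cancelʳ-≤-pos P {{positive 0<P}} (begin
  missBound L ^ d * fromℕ (n ℕ.^ 3) * P
    ≡⟨ solve 3 (λ x y z → x :* y :* z := x :* z :* y) refl (missBound L ^ d) (fromℕ (n ℕ.^ 3)) P ⟩
  missBound L ^ d * P * fromℕ (n ℕ.^ 3)
    ≡⟨ cong (_* fromℕ (n ℕ.^ 3)) (missBound^d*[1+L]^d≡L^d L d) ⟩
  fromℕ (L ℕ.^ d) * fromℕ (n ℕ.^ 3)
    ≡⟨ fromℕ-homo-* (L ℕ.^ d) (n ℕ.^ 3) ⟨
  fromℕ (L ℕ.^ d ℕ.* n ℕ.^ 3)
    ≤⟨ fromℕ-mono-≤ (L^d*n³≤[1+L]^d*decayConstant L b d n n≤db) ⟩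
  fromℕ (suc L ℕ.^ d ℕ.* K)
    ≡⟨ fromℕ-homo-* (suc L ℕ.^ d) K ⟩
  P * fromℕ K
    ≡⟨ ℚ.*-comm P (fromℕ K) ⟩
  fromℕ K * P
    ∎)
  where
  open ℚ.≤-Reasoning
  open +-*-Solver
  K : ℕ
  K = decayConstant L b
  P : ℚ
  P = fromℕ (suc L ℕ.^ d)
  0<P : 0ℚ <ℚ P
  0<P = fromℕ-mono-< (ℕ.m^n>0 (suc L) d)

x*n³≤n²*K⇒x<ε : ∀ {x ε} b K n → 0ℚ <ℚ ε → 1ℚ ≤ ε * fromℕ b → K ℕ.* b ℕ.< n →
               x * fromℕ (n ℕ.^ 3) ≤ fromℕ (n ℕ.* n ℕ.* K) → x <ℚ ε
x*n³≤n²*K⇒x<ε {x} {ε} b K n@(suc _) 0<ε 1≤εb Kb<n x*n³≤n²*K =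
  ℚ.*-cancelʳ-<-nonNeg (fromℕ (n ℕ.^ 3)) {{nonNegative (fromℕ-nonNeg (n ℕ.^ 3))}} (begin-strict
    x * fromℕ (n ℕ.^ 3)
      ≤⟨ x*n³≤n²*K ⟩
    fromℕ (n ℕ.* n ℕ.* K)
      ≡⟨ ℚ.*-identityˡ _ ⟨
    1ℚ * fromℕ (n ℕ.* n ℕ.* K)
      ≤⟨ ℚ.*-monoʳ-≤-nonNeg _ {{nonNegative (fromℕ-nonNeg (n ℕ.* n ℕ.* K))}} 1≤εb ⟩
    ε * fromℕ b * fromℕ (n ℕ.* n ℕ.* K)
      ≡⟨ ℚ.*-assoc ε (fromℕ b) _ ⟩
    ε * (fromℕ b * fromℕ (n ℕ.* n ℕ.* K))
      ≡⟨ cong (ε *_) (fromℕ-homo-* b (n ℕ.* n ℕ.* K)) ⟨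
    ε * fromℕ (b ℕ.* (n ℕ.* n ℕ.* K))
      <⟨ ℚ.*-monoʳ-<-pos ε {{positive 0<ε}} (fromℕ-mono-< n²Kb<n³) ⟩
    ε * fromℕ (n ℕ.^ 3)
      ∎)
  where
  open ℚ.≤-Reasoning
  n²Kb<n³ : b ℕ.* (n ℕ.* n ℕ.* K) ℕ.< n ℕ.^ 3
  n²Kb<n³ = subst₂ ℕ._<_ (solve 3 (λ b n K → n :* n :* (K :* b) := b :* (n :* n :* K)) refl b n K)
    (solve 1 (λ n → n :* n :* n := n :^ 3) refl n) (ℕ.*-monoʳ-< (n ℕ.* n) Kb<n)
    where open ℕ-Solver

-- Finite sums and expectations

𝔼 : List (ℚ × A) → (A → ℚ) → ℚ
𝔼 []            f = 0ℚ
𝔼 ((w , x) ∷ D) f = w * f x + 𝔼 D f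

NonNegWeights : List (ℚ × A) → Set
NonNegWeights = All (λ wx → 0ℚ ≤ proj₁ wx)

∑ : List A → (A → ℚ) → ℚ
∑ []       f = 0ℚ
∑ (x ∷ xs) f = f x + ∑ xs f

𝔼-cong : ∀ D {f g : A → ℚ} → (∀ x → f x ≡ g x) → 𝔼 D f ≡ 𝔼 D g
𝔼-cong []            f≗g = refl
𝔼-cong ((w , x) ∷ D) f≗g = cong₂ (λ a b → w * a + b) (f≗g x) (𝔼-cong D f≗g)

𝔼-++ : ∀ D₁ D₂ (f : A → ℚ) → 𝔼 (D₁ ++ D₂) f ≡ 𝔼 D₁ f + 𝔼 D₂ f
𝔼-++ []             D₂ f = sym (ℚ.+-identityˡ (𝔼 D₂ f))
𝔼-++ ((w , x) ∷ D₁) D₂ f =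
  trans (cong (_+_ (w * f x)) (𝔼-++ D₁ D₂ f)) (sym (ℚ.+-assoc (w * f x) (𝔼 D₁ f) (𝔼 D₂ f)))

𝔼-0 : ∀ (D : List (ℚ × A)) → 𝔼 D (λ _ → 0ℚ) ≡ 0ℚ
𝔼-0 []            = refl
𝔼-0 ((w , x) ∷ D) = trans (cong (_+_ (w * 0ℚ)) (𝔼-0 D)) (trans (ℚ.+-identityʳ (w * 0ℚ)) (ℚ.*-zeroʳ w))

𝔼-+ : ∀ D (f g : A → ℚ) → 𝔼 D (λ x → f x + g x) ≡ 𝔼 D f + 𝔼 D g
𝔼-+ []            f g = refl
𝔼-+ ((w , x) ∷ D) f g = trans (cong (_+_ (w * (f x + g x))) (𝔼-+ D f g))
  (solve 5 (λ w a b r s → w :* (a :+ b) :+ (r :+ s) := (w :* a :+ r) :+ (w :* b :+ s)) refl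
     w (f x) (g x) (𝔼 D f) (𝔼 D g))
  where open +-*-Solver

𝔼-*ˡ : ∀ D c (f : A → ℚ) → 𝔼 D (λ x → c * f x) ≡ c * 𝔼 D f
𝔼-*ˡ []            c f = sym (ℚ.*-zeroʳ c)
𝔼-*ˡ ((w , x) ∷ D) c f = trans (cong (_+_ (w * (c * f x))) (𝔼-*ˡ D c f))
  (solve 4 (λ w c a r → w :* (c :* a) :+ c :* r := c :* (w :* a :+ r)) refl w c (f x) (𝔼 D f))
  where open +-*-Solver

𝔼-*ʳ : ∀ D c (f : A → ℚ) → 𝔼 D (λ x → f x * c) ≡ 𝔼 D f * c
𝔼-*ʳ D c f = trans (𝔼-cong D (λ x → ℚ.*-comm (f x) c)) (trans (𝔼-*ˡ D c f) (ℚ.*-comm c (𝔼 D f)))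

𝔼-∑ : ∀ D (ys : List B) (F : B → A → ℚ) → 𝔼 D (λ x → ∑ ys (λ y → F y x)) ≡ ∑ ys (λ y → 𝔼 D (F y))
𝔼-∑ D []       F = 𝔼-0 D
𝔼-∑ D (y ∷ ys) F = trans (𝔼-+ D (F y) (λ x → ∑ ys (λ y → F y x))) (cong (_+_ (𝔼 D (F y))) (𝔼-∑ D ys F))

𝔼-mono : ∀ {D} {f g : A → ℚ} → NonNegWeights D → (∀ x → f x ≤ g x) → 𝔼 D f ≤ 𝔼 D g
𝔼-mono {D = []}          []          f≤g = ℚ.≤-refl
𝔼-mono {D = (w , x) ∷ D} (0≤w ∷ 0≤D) f≤g =
  ℚ.+-mono-≤ (ℚ.*-monoˡ-≤-nonNeg w {{nonNegative 0≤w}} (f≤g x)) (𝔼-mono 0≤D f≤g)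

𝔼-nonNeg : ∀ {D} {f : A → ℚ} → NonNegWeights D → (∀ x → 0ℚ ≤ f x) → 0ℚ ≤ 𝔼 D f
𝔼-nonNeg {D = D} {f} 0≤D 0≤f = subst (_≤ 𝔼 D f) (𝔼-0 D) (𝔼-mono 0≤D 0≤f)

𝔼-≤-1 : ∀ {D} {f : A → ℚ} → NonNegWeights D → 𝔼 D (λ _ → 1ℚ) ≡ 1ℚ → (∀ x → f x ≤ 1ℚ) → 𝔼 D f ≤ 1ℚ
𝔼-≤-1 {D = D} {f} 0≤D mass≡1 f≤1 = subst (𝔼 D f ≤_) mass≡1 (𝔼-mono 0≤D f≤1)

productWith : (A → B → C) → List (ℚ × A) → List (ℚ × B) → List (ℚ × C)
productWith _∙_ D₁ D₂ = concatMap (λ a → map (λ b → (proj₁ a * proj₁ b , proj₂ a ∙ proj₂ b)) D₂) D₁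

module _ (_∙_ : A → B → C) where

  𝔼-productWith : ∀ D₁ D₂ f → 𝔼 (productWith _∙_ D₁ D₂) f ≡ 𝔼 D₁ (λ x → 𝔼 D₂ (λ y → f (x ∙ y)))
  𝔼-productWith []             D₂ f = refl
  𝔼-productWith ((w , x) ∷ D₁) D₂ f =
    trans (𝔼-++ (map (λ b → (w * proj₁ b , x ∙ proj₂ b)) D₂) _ f)
          (cong₂ _+_ (𝔼-scaled D₂) (𝔼-productWith D₁ D₂ f))
    where
    𝔼-scaled : ∀ D → 𝔼 (map (λ b → (w * proj₁ b , x ∙ proj₂ b)) D) f ≡ w * 𝔼 D (λ y → f (x ∙ y))
    𝔼-scaled []             = sym (ℚ.*-zeroʳ w)
    𝔼-scaled ((v , y) ∷ D) = trans (cong (_+_ (w * v * f (x ∙ y))) (𝔼-scaled D))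
      (solve 4 (λ w v a r → w :* v :* a :+ w :* r := w :* (v :* a :+ r)) refl
         w v (f (x ∙ y)) (𝔼 D (λ y → f (x ∙ y))))
      where open +-*-Solver

  𝔼-productWith-* : ∀ D₁ D₂ {f g h} → (∀ x y → f (x ∙ y) ≡ g x * h y) →
                    𝔼 (productWith _∙_ D₁ D₂) f ≡ 𝔼 D₁ g * 𝔼 D₂ h
  𝔼-productWith-* D₁ D₂ {f} {g} {h} f≡g*h = begin
    𝔼 (productWith _∙_ D₁ D₂) f            ≡⟨ 𝔼-productWith D₁ D₂ f ⟩
    𝔼 D₁ (λ x → 𝔼 D₂ (λ y → f (x ∙ y)))    ≡⟨ 𝔼-cong D₁ (λ x → trans (𝔼-cong D₂ (f≡g*h x)) (𝔼-*ˡ D₂ (g x) h)) ⟩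
    𝔼 D₁ (λ x → g x * 𝔼 D₂ h)              ≡⟨ 𝔼-*ʳ D₁ (𝔼 D₂ h) g ⟩
    𝔼 D₁ g * 𝔼 D₂ h                        ∎
    where open ≡-Reasoning

  productWith-nonNeg : ∀ {D₁ D₂} → NonNegWeights D₁ → NonNegWeights D₂ → NonNegWeights (productWith _∙_ D₁ D₂)
  productWith-nonNeg {D₁ = []}    []            0≤D₂ = []
  productWith-nonNeg {D₁ = (w , x) ∷ _} (0≤w ∷ 0≤D₁) 0≤D₂ =
    ++⁺ (scaled-nonNeg 0≤D₂) (productWith-nonNeg 0≤D₁ 0≤D₂)
    where
    scaled-nonNeg : ∀ {D} → NonNegWeights D → NonNegWeights (map (λ b → (w * proj₁ b , x ∙ proj₂ b)) D)
    scaled-nonNeg []          = []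
    scaled-nonNeg (0≤v ∷ 0≤D) = *-nonNeg 0≤w 0≤v ∷ scaled-nonNeg 0≤D

∑-const : ∀ (xs : List A) c → ∑ xs (λ _ → c) ≡ fromℕ (length xs) * c
∑-const []       c = sym (ℚ.*-zeroˡ c)
∑-const (x ∷ xs) c = begin
  c + ∑ xs (λ _ → c)
    ≡⟨ cong (_+_ c) (∑-const xs c) ⟩
  c + fromℕ (length xs) * c
    ≡⟨ solve 2 (λ c l → c :+ l :* c := (con 1ℚ :+ l) :* c) refl c (fromℕ (length xs)) ⟩
  (1ℚ + fromℕ (length xs)) * c
    ≡⟨ cong (_* c) (fromℕ-suc (length xs)) ⟨
  fromℕ (suc (length xs)) * c
    ∎
  where open ≡-Reasoning; open +-*-Solver

∑-*ʳ : ∀ (xs : List A) f c → ∑ xs f * c ≡ ∑ xs (λ x → f x * c)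
∑-*ʳ []       f c = ℚ.*-zeroˡ c
∑-*ʳ (x ∷ xs) f c = trans (ℚ.*-distribʳ-+ c (f x) (∑ xs f)) (cong (_+_ (f x * c)) (∑-*ʳ xs f c))

∑-mono : ∀ (xs : List A) {f g} → (∀ x → x ∈ xs → f x ≤ g x) → ∑ xs f ≤ ∑ xs g
∑-mono []       f≤g = ℚ.≤-refl
∑-mono (x ∷ xs) f≤g = ℚ.+-mono-≤ (f≤g x (here refl)) (∑-mono xs (λ y y∈xs → f≤g y (there y∈xs)))

∑-nonNeg : ∀ (xs : List A) {f} → (∀ x → 0ℚ ≤ f x) → 0ℚ ≤ ∑ xs f
∑-nonNeg xs {f} 0≤f =
  subst (_≤ ∑ xs f) (trans (∑-const xs 0ℚ) (ℚ.*-zeroʳ (fromℕ (length xs)))) (∑-mono xs (λ x _ → 0≤f x))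

∑-≤-length* : ∀ (xs : List A) {f} c → (∀ x → x ∈ xs → f x ≤ c) → ∑ xs f ≤ fromℕ (length xs) * c
∑-≤-length* xs c f≤c = subst (∑ xs _ ≤_) (∑-const xs c) (∑-mono xs f≤c)

∑-≤-length∸1 : ∀ (xs : List A) {f x} → (∀ y → f y ≤ 1ℚ) → x ∈ xs → f x ≡ 0ℚ → ∑ xs f ≤ fromℕ (length xs ∸ 1)
∑-≤-length∸1 (y ∷ xs) {f} f≤1 (here refl) fx≡0 = begin
  f y + ∑ xs f                ≡⟨ cong (_+ ∑ xs f) fx≡0 ⟩
  0ℚ + ∑ xs f                 ≡⟨ ℚ.+-identityˡ (∑ xs f) ⟩
  ∑ xs f                      ≤⟨ ∑-≤-length* xs 1ℚ (λ z _ → f≤1 z) ⟩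
  fromℕ (length xs) * 1ℚ      ≡⟨ ℚ.*-identityʳ (fromℕ (length xs)) ⟩
  fromℕ (length xs)           ∎
  where open ℚ.≤-Reasoning
∑-≤-length∸1 (y ∷ z ∷ xs) {f} f≤1 (there x∈xs) fx≡0 =
  subst (f y + ∑ (z ∷ xs) f ≤_) (sym (fromℕ-suc (length xs)))
        (ℚ.+-mono-≤ (f≤1 y) (∑-≤-length∸1 (z ∷ xs) f≤1 x∈xs fx≡0))

𝟙 : Bool → ℚ
𝟙 true  = 1ℚ
𝟙 false = 0ℚ

𝟙-nonNeg : ∀ b → 0ℚ ≤ 𝟙 b
𝟙-nonNeg true  = ℚ.nonNegative⁻¹ 1ℚ
𝟙-nonNeg false = ℚ.≤-refl

𝟙-≤-1 : ∀ b → 𝟙 b ≤ 1ℚ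
𝟙-≤-1 true  = ℚ.≤-refl
𝟙-≤-1 false = ℚ.nonNegative⁻¹ 1ℚ

𝟙+𝟙-not : ∀ b → 𝟙 b + 𝟙 (not b) ≡ 1ℚ
𝟙+𝟙-not true  = refl
𝟙+𝟙-not false = refl

𝟙-not-∨ : ∀ a b → 𝟙 (not (a ∨ b)) ≡ 𝟙 (not a) * 𝟙 (not b)
𝟙-not-∨ true  true  = refl
𝟙-not-∨ true  false = refl
𝟙-not-∨ false true  = refl
𝟙-not-∨ false false = refl

union-bound : ∀ (f : A → Bool) xs → 𝟙 (not (all f xs)) ≤ ∑ xs (𝟙 ∘ not ∘ f)
union-bound f []       = ℚ.≤-refl
union-bound f (x ∷ xs) with f x
... | true  = subst (𝟙 (not (all f xs)) ≤_) (sym (ℚ.+-identityˡ _)) (union-bound f xs)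
... | false = subst (_≤ 1ℚ + ∑ xs (𝟙 ∘ not ∘ f)) (ℚ.+-identityʳ 1ℚ)
                    (ℚ.+-monoʳ-≤ 1ℚ (∑-nonNeg xs (𝟙-nonNeg ∘ not ∘ f)))

any-++ : ∀ (p : A → Bool) xs ys → any p (xs ++ ys) ≡ any p xs ∨ any p ys
any-++ p []       ys = refl
any-++ p (x ∷ xs) ys = trans (cong (p x ∨_) (any-++ p xs ys)) (sym (Bool.∨-assoc (p x) (any p xs) (any p ys)))

-- Counting pairs

count : (A → Bool) → List A → ℕ
count q xs = length (filter (λ x → q x Bool.≟ true) xs)

count-++ : ∀ (q : A → Bool) xs ys → count q (xs ++ ys) ≡ count q xs ℕ.+ count q ys
count-++ q xs ys = trans (cong length (List.filter-++ (λ x → q x Bool.≟ true) xs ys)) (List.length-++ (filter _ xs))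

count-map : ∀ (q : B → Bool) (f : A → B) xs → count q (map f xs) ≡ count (q ∘ f) xs
count-map q f []       = refl
count-map q f (x ∷ xs) with q (f x)
... | true  = cong suc (count-map q f xs)
... | false = count-map q f xs

count-false : ∀ (xs : List A) → count (λ _ → false) xs ≡ 0
count-false []       = refl
count-false (x ∷ xs) = count-false xs

count-∧ˡ-≤ : ∀ b (q : A → Bool) xs → count (λ x → b ∧ q x) xs ℕ.≤ count q xs
count-∧ˡ-≤ true  q xs = ℕ.≤-refl
count-∧ˡ-≤ false q xs = subst (ℕ._≤ count q xs) (sym (count-false xs)) z≤n

count-filter-≤ : ∀ (q : A → Bool) {P : A → Set} (P? : Decidable P) xs → count q (filter P? xs) ℕ.≤ count q xs
count-filter-≤ q P? xs = Sublist.length-mono-≤ (Sublist.filter⁺ _ _ (λ { refl qx → qx }) (Sublist.filter-⊆ P? xs))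

count-concatMap-≤ : ∀ (q : A → Bool) (r : B → Bool) (g : A → List B) K xs →
                    (∀ x → q x ≡ false → count r (g x) ≡ 0) → (∀ x → count r (g x) ℕ.≤ K) →
                    count r (concatMap g xs) ℕ.≤ count q xs ℕ.* K
count-concatMap-≤ q r g K []       outside bounded = z≤n
count-concatMap-≤ q r g K (x ∷ xs) outside bounded rewrite count-++ r (g x) (concatMap g xs) with q x in qx
... | true  = ℕ.+-mono-≤ (bounded x) (count-concatMap-≤ q r g K xs outside bounded)
... | false = ℕ.≤-trans (ℕ.≤-reflexive (cong (ℕ._+ _) (outside x qx))) (count-concatMap-≤ q r g K xs outside bounded)

count-tabulate-suc : ∀ {n} (q : Fin (suc n) → Bool) → count q (tabulate Fin.suc) ≡ count (q ∘ Fin.suc) (allFin n)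
count-tabulate-suc {n} q = trans (cong (count q) (sym (List.map-tabulate id Fin.suc))) (count-map q Fin.suc (allFin n))

count-allFin : ∀ {n} (S : Subset n) → count (λ i → mem i S) (allFin n) ≡ Subset.∣ S ∣
count-allFin []          = refl
count-allFin (true  ∷ S) = cong suc (trans (count-tabulate-suc (λ i → mem i (true ∷ S))) (count-allFin S))
count-allFin (false ∷ S) = trans (count-tabulate-suc (λ i → mem i (false ∷ S))) (count-allFin S)

length-concatMap-≤ : ∀ (f : A → List B) K xs → (∀ x → length (f x) ℕ.≤ K) → length (concatMap f xs) ℕ.≤ length xs ℕ.* K
length-concatMap-≤ f K []       bounded = z≤n
length-concatMap-≤ f K (x ∷ xs) bounded = subst (ℕ._≤ K ℕ.+ length xs ℕ.* K) (sym (List.length-++ (f x)))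
  (ℕ.+-mono-≤ (bounded x) (length-concatMap-≤ f K xs bounded))

module _ {n : ℕ} where

  above : Fin n → List (Fin n)
  above i = filter (i Fin.<?_) (allFin n)

  row : Fin n → List (Fin n × Fin n)
  row i = map (i ,_) (above i)

  ∈-allPairs⁺ : ∀ {i j : Fin n} → i < j → (i , j) ∈ allPairs n
  ∈-allPairs⁺ {i} {j} i<j =
    ∈-concatMap⁺ row (lose {P = λ i′ → (i , j) ∈ row i′} (∈-allFin i)
      (∈-map⁺ (i ,_) (∈-filter⁺ (i Fin.<?_) (∈-allFin j) i<j)))

  ∈-allPairs⁻ : ∀ {i j : Fin n} → (i , j) ∈ allPairs n → i < j
  ∈-allPairs⁻ ij∈ with satisfied (∈-concatMap⁻ row {allFin n} ij∈)
  ... | i′ , ij∈row with ∈-map⁻ (i′ ,_) ij∈row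
  ... | j′ , j′∈ , refl = proj₂ (∈-filter⁻ (i′ Fin.<?_) {xs = allFin n} j′∈)

  length-allPairs : length (allPairs n) ℕ.≤ n ℕ.* n
  length-allPairs = subst (λ m → length (allPairs n) ℕ.≤ m ℕ.* n) (List.length-tabulate {n = n} id)
    (length-concatMap-≤ row n (allFin n) λ i → begin
      length (row i)                              ≡⟨ List.length-map (i ,_) (above i) ⟩
      length (above i)                            ≤⟨ List.length-filter (i Fin.<?_) (allFin n) ⟩
      length (allFin n)                           ≡⟨ List.length-tabulate {n = n} id ⟩
      n                                           ∎)
    where open ℕ.≤-Reasoning

  ∈-pairsIn⁺ : ∀ (S : Subset n) {i j} → i < j → (mem i S ∧ mem j S) ≡ true → (i , j) ∈ pairsIn S
  ∈-pairsIn⁺ S i<j ij∈S = ∈-filter⁺ (λ p → (mem (proj₁ p) S ∧ mem (proj₂ p) S) Bool.≟ true) (∈-allPairs⁺ i<j) ij∈S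

  length-pairsIn : ∀ (S : Subset n) → length (pairsIn S) ℕ.≤ Subset.∣ S ∣ ℕ.* Subset.∣ S ∣
  length-pairsIn S = subst (λ m → length (pairsIn S) ℕ.≤ m ℕ.* Subset.∣ S ∣) (count-allFin S)
    (count-concatMap-≤ (λ i → mem i S) both row Subset.∣ S ∣ (allFin n) outside bounded)
    where
    both : Fin n × Fin n → Bool
    both (i , j) = mem i S ∧ mem j S
    outside : ∀ i → mem i S ≡ false → count both (row i) ≡ 0
    outside i i∉S = trans (count-map both (i ,_) (above i))
      (subst (λ b → count (λ j → b ∧ mem j S) (above i) ≡ 0) (sym i∉S) (count-false (above i)))
    bounded : ∀ i → count both (row i) ℕ.≤ Subset.∣ S ∣
    bounded i = begin
      count both (row i)
        ≡⟨ count-map both (i ,_) (above i) ⟩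
      count (λ j → mem i S ∧ mem j S) (above i)
        ≤⟨ count-∧ˡ-≤ (mem i S) (λ j → mem j S) (above i) ⟩
      count (λ j → mem j S) (above i)
        ≤⟨ count-filter-≤ (λ j → mem j S) (i Fin.<?_) (allFin n) ⟩
      count (λ j → mem j S) (allFin n)
        ≡⟨ count-allFin S ⟩
      Subset.∣ S ∣
        ∎
      where open ℕ.≤-Reasoning

-- The random multigraph 𝔾(n,1;H)

-- Prob sums through a helper local to its definition, so it is pinned down by its defining equations.
𝔼-𝟙-characterisation : ∀ (P : A → Bool) (F : List (ℚ × A) → ℚ) → F [] ≡ 0ℚ →
                        (∀ w x D → F ((w , x) ∷ D) ≡ (if P x then w else 0ℚ) + F D) →
                        ∀ D → F D ≡ 𝔼 D (𝟙 ∘ P)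
𝔼-𝟙-characterisation P F F[] F∷ []            = F[]
𝔼-𝟙-characterisation P F F[] F∷ ((w , x) ∷ D) =
  trans (F∷ w x D) (cong₂ _+_ (selected (P x)) (𝔼-𝟙-characterisation P F F[] F∷ D))
  where
  selected : ∀ b → (if b then w else 0ℚ) ≡ w * 𝟙 b
  selected true  = sym (ℚ.*-identityʳ w)
  selected false = sym (ℚ.*-zeroʳ w)

Prob≡𝔼 : ∀ {n} p (H : Hypergraph n) P → Prob p H P ≡ 𝔼 (Gdist p H) (𝟙 ∘ P)
Prob≡𝔼 p H P with 𝔼-𝟙-characterisation P _ refl (λ _ _ _ → refl) | Gdist p H
... | characterisation | D = characterisation D

module _ {n : ℕ} (i j : Fin n) where

  notJoined : Multigraph n → ℚ
  notJoined g = 𝟙 (not (joined g i j))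

  joined-++ : ∀ (g h : Multigraph n) → joined (g ++ h) i j ≡ joined g i j ∨ joined h i j
  joined-++ = any-++ _

  notJoined-++ : ∀ (g h : Multigraph n) → notJoined (g ++ h) ≡ notJoined g * notJoined h
  notJoined-++ g h = trans (cong (𝟙 ∘ not) (joined-++ g h)) (𝟙-not-∨ (joined g i j) (joined h i j))

  notJoined-nonNeg : ∀ g → 0ℚ ≤ notJoined g
  notJoined-nonNeg g = 𝟙-nonNeg (not (joined g i j))

  notJoined-≤-1 : ∀ g → notJoined g ≤ 1ℚ
  notJoined-≤-1 g = 𝟙-≤-1 (not (joined g i j))

  joined-edge : joined ((i , j) ∷ []) i j ≡ true
  joined-edge rewrite isYes≗does (i Fin.≟ i) | dec-true (i Fin.≟ i) refl
                    | isYes≗does (j Fin.≟ j) | dec-true (j Fin.≟ j) refl = refl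

-- stepOutcomes p S reduces to edgeChoices m p (pairsIn S) when S has suc m pairs.
edgeChoices : ℕ → ℚ → List A → List (ℚ × List A)
edgeChoices m p = concatMap (λ e → (1/suc m * p , e ∷ []) ∷ (1/suc m * (1ℚ - p) , []) ∷ [])

module _ (m : ℕ) where

  𝔼-edgeChoices : ∀ (es : List A) f → 𝔼 (edgeChoices m 1ℚ es) f ≡ 1/suc m * ∑ es (λ e → f (e ∷ []))
  𝔼-edgeChoices []       f = sym (ℚ.*-zeroʳ (1/suc m))
  𝔼-edgeChoices (e ∷ es) f =
    trans (cong (λ r → 1/suc m * 1ℚ * f (e ∷ []) + (1/suc m * (1ℚ - 1ℚ) * f [] + r)) (𝔼-edgeChoices es f))
    (solve 4 (λ u x y s → u :* con 1ℚ :* x :+ (u :* (con 1ℚ :- con 1ℚ) :* y :+ u :* s) := u :* (x :+ s)) refl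
       (1/suc m) (f (e ∷ [])) (f []) (∑ es (λ e → f (e ∷ []))))
    where open +-*-Solver

  edgeChoices-nonNeg : ∀ (es : List A) → NonNegWeights (edgeChoices m 1ℚ es)
  edgeChoices-nonNeg []       = []
  edgeChoices-nonNeg (e ∷ es) =
    *-nonNeg (1/suc-nonNeg m) (fromℕ-nonNeg 1) ∷ *-nonNeg (1/suc-nonNeg m) ℚ.≤-refl ∷ edgeChoices-nonNeg es

module _ {n : ℕ} (S : Subset n) where

  stepOutcomes-nonNeg : NonNegWeights (stepOutcomes 1ℚ S)
  stepOutcomes-nonNeg with length (pairsIn S)
  ... | zero  = fromℕ-nonNeg 1 ∷ []
  ... | suc m = edgeChoices-nonNeg m (pairsIn S)

  stepOutcomes-mass : 𝔼 (stepOutcomes 1ℚ S) (λ _ → 1ℚ) ≡ 1ℚ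
  stepOutcomes-mass with length (pairsIn S) in eq
  ... | zero  = refl
  ... | suc m = begin
    𝔼 (edgeChoices m 1ℚ (pairsIn S)) (λ _ → 1ℚ)     ≡⟨ 𝔼-edgeChoices m (pairsIn S) (λ _ → 1ℚ) ⟩
    1/suc m * ∑ (pairsIn S) (λ _ → 1ℚ)              ≡⟨ cong (1/suc m *_) (∑-const (pairsIn S) 1ℚ) ⟩
    1/suc m * (fromℕ (length (pairsIn S)) * 1ℚ)     ≡⟨ cong (λ l → 1/suc m * (fromℕ l * 1ℚ)) eq ⟩
    1/suc m * (fromℕ (suc m) * 1ℚ)                  ≡⟨ cong (1/suc m *_) (ℚ.*-identityʳ (fromℕ (suc m))) ⟩
    1/suc m * fromℕ (suc m)                         ≡⟨ 1/suc-inverse m ⟩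
    1ℚ                                              ∎
    where open ≡-Reasoning

  stepOutcomes-notJoined-≤-missBound : ∀ {i j} L → length (pairsIn S) ℕ.≤ L → (i , j) ∈ pairsIn S →
                                       𝔼 (stepOutcomes 1ℚ S) (notJoined i j) ≤ missBound L
  stepOutcomes-notJoined-≤-missBound {i} {j} L ≤L ij∈S with length (pairsIn S) in eq
  ... | zero  = ⊥-elim (ℕ.<-irrefl refl (subst (0 ℕ.<_) eq (∈-length ij∈S)))
  ... | suc m = begin
    𝔼 (edgeChoices m 1ℚ (pairsIn S)) (notJoined i j)
      ≡⟨ 𝔼-edgeChoices m (pairsIn S) (notJoined i j) ⟩
    1/suc m * ∑ (pairsIn S) (λ e → notJoined i j (e ∷ []))
      ≤⟨ ℚ.*-monoˡ-≤-nonNeg (1/suc m) {{nonNegative (1/suc-nonNeg m)}} ∑≤m ⟩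
    1/suc m * fromℕ m
      ≡⟨ 1/suc*fromℕ≡missBound m ⟩
    missBound m
      ≤⟨ missBound-mono (ℕ.≤-trans (ℕ.n≤1+n m) ≤L) ⟩
    missBound L
      ∎
    where
    open ℚ.≤-Reasoning
    ∑≤m : ∑ (pairsIn S) (λ e → notJoined i j (e ∷ [])) ≤ fromℕ m
    ∑≤m = subst (λ l → ∑ (pairsIn S) (λ e → notJoined i j (e ∷ [])) ≤ fromℕ (l ∸ 1)) eq
      (∑-≤-length∸1 (pairsIn S) (λ e → notJoined-≤-1 i j (e ∷ [])) ij∈S (cong (𝟙 ∘ not) (joined-edge i j)))

  stepOutcomes-notJoined-≤ : ∀ L {i j} → length (pairsIn S) ℕ.≤ L → i < j →
                             𝔼 (stepOutcomes 1ℚ S) (notJoined i j) ≤ (if mem i S ∧ mem j S then missBound L else 1ℚ)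
  stepOutcomes-notJoined-≤ L {i} {j} ≤L i<j with mem i S ∧ mem j S in ij∈S
  ... | true  = stepOutcomes-notJoined-≤-missBound L ≤L (∈-pairsIn⁺ S i<j ij∈S)
  ... | false = 𝔼-≤-1 stepOutcomes-nonNeg stepOutcomes-mass (notJoined-≤-1 i j)

^-deg-∷ : ∀ {n} x S (H : Hypergraph n) i j →
          x ^ deg (S ∷ H) i j ≡ (if mem i S ∧ mem j S then x else 1ℚ) * x ^ deg H i j
^-deg-∷ x S H i j with mem i S ∧ mem j S
... | true  = refl
... | false = sym (ℚ.*-identityˡ (x ^ deg H i j))

module _ {n : ℕ} where

  Gdist-nonNeg : ∀ (H : Hypergraph n) → NonNegWeights (Gdist 1ℚ H)
  Gdist-nonNeg []      = fromℕ-nonNeg 1 ∷ []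
  Gdist-nonNeg (S ∷ H) = productWith-nonNeg _++_ (stepOutcomes-nonNeg S) (Gdist-nonNeg H)

  Gdist-mass : ∀ (H : Hypergraph n) → 𝔼 (Gdist 1ℚ H) (λ _ → 1ℚ) ≡ 1ℚ
  Gdist-mass []      = refl
  Gdist-mass (S ∷ H) = trans (𝔼-productWith-* _++_ (stepOutcomes 1ℚ S) (Gdist 1ℚ H) (λ _ _ → refl))
                             (cong₂ _*_ (stepOutcomes-mass S) (Gdist-mass H))

  notJoined-≤-missBound^deg : ∀ L (H : Hypergraph n) → All (λ S → length (pairsIn S) ℕ.≤ L) H → ∀ {i j} → i < j →
                              𝔼 (Gdist 1ℚ H) (notJoined i j) ≤ missBound L ^ deg H i j
  notJoined-≤-missBound^deg L []      []           i<j = ℚ.≤-refl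
  notJoined-≤-missBound^deg L (S ∷ H) (≤L ∷ H≤L) {i} {j} i<j = begin
    𝔼 (Gdist 1ℚ (S ∷ H)) (notJoined i j)
      ≡⟨ 𝔼-productWith-* _++_ (stepOutcomes 1ℚ S) (Gdist 1ℚ H) (notJoined-++ i j) ⟩
    𝔼 (stepOutcomes 1ℚ S) (notJoined i j) * 𝔼 (Gdist 1ℚ H) (notJoined i j)
      ≤⟨ *-mono-≤-nonNeg (𝔼-nonNeg (stepOutcomes-nonNeg S) (notJoined-nonNeg i j))
                         (^-nonNeg (missBound-nonNeg L) (deg H i j))
                         (stepOutcomes-notJoined-≤ S L ≤L i<j) (notJoined-≤-missBound^deg L H H≤L i<j) ⟩
    (if mem i S ∧ mem j S then missBound L else 1ℚ) * missBound L ^ deg H i j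
      ≡⟨ ^-deg-∷ (missBound L) S H i j ⟨
    missBound L ^ deg (S ∷ H) i j ∎
    where open ℚ.≤-Reasoning

  ∣Prob-1∣≡𝔼-not : ∀ (H : Hypergraph n) P → ∣ Prob 1ℚ H P - 1ℚ ∣ ≡ 𝔼 (Gdist 1ℚ H) (𝟙 ∘ not ∘ P)
  ∣Prob-1∣≡𝔼-not H P = begin
    ∣ Prob 1ℚ H P - 1ℚ ∣                  ≡⟨ cong₂ (λ p q → ∣ p - q ∣) (Prob≡𝔼 1ℚ H P) (sym total) ⟩
    ∣ yes - (yes + no) ∣                  ≡⟨ cong ∣_∣ (solve 2 (λ y z → y :- (y :+ z) := :- z) refl yes no) ⟩
    ∣ - no ∣                              ≡⟨ ℚ.∣-p∣≡∣p∣ no ⟩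
    ∣ no ∣                                ≡⟨ ℚ.0≤p⇒∣p∣≡p (𝔼-nonNeg (Gdist-nonNeg H) (𝟙-nonNeg ∘ not ∘ P)) ⟩
    no                                    ∎
    where
    open ≡-Reasoning
    open +-*-Solver
    D : List (ℚ × Multigraph n)
    D = Gdist 1ℚ H
    yes : ℚ
    yes = 𝔼 D (𝟙 ∘ P)
    no : ℚ
    no = 𝔼 D (𝟙 ∘ not ∘ P)
    total : yes + no ≡ 1ℚ
    total = trans (sym (𝔼-+ D (𝟙 ∘ P) (𝟙 ∘ not ∘ P))) (trans (𝔼-cong D (𝟙+𝟙-not ∘ P)) (Gdist-mass H))

  𝔼-incomplete*n³≤n²*decayConstant : ∀ L b (H : Hypergraph n) → All (λ S → length (pairsIn S) ℕ.≤ L) H →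
                                     (∀ {i j} → i < j → n ℕ.≤ deg H i j ℕ.* b) →
                                     𝔼 (Gdist 1ℚ H) (𝟙 ∘ not ∘ Complete) * fromℕ (n ℕ.^ 3)
                                       ≤ fromℕ (n ℕ.* n ℕ.* decayConstant L b)
  𝔼-incomplete*n³≤n²*decayConstant L b H H≤L n≤deg*b = begin
    𝔼 D (𝟙 ∘ not ∘ Complete) * n³
      ≤⟨ ℚ.*-monoʳ-≤-nonNeg n³ {{nonNegative (fromℕ-nonNeg (n ℕ.^ 3))}} union ⟩
    ∑ (allPairs n) missing * n³
      ≡⟨ ∑-*ʳ (allPairs n) missing n³ ⟩
    ∑ (allPairs n) (λ p → missing p * n³)
      ≤⟨ ∑-≤-length* (allPairs n) (fromℕ K) per-pair ⟩
    fromℕ (length (allPairs n)) * fromℕ K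
      ≤⟨ ℚ.*-monoʳ-≤-nonNeg (fromℕ K) {{nonNegative (fromℕ-nonNeg K)}} (fromℕ-mono-≤ (length-allPairs {n})) ⟩
    fromℕ (n ℕ.* n) * fromℕ K
      ≡⟨ fromℕ-homo-* (n ℕ.* n) K ⟨
    fromℕ (n ℕ.* n ℕ.* K)
      ∎
    where
    open ℚ.≤-Reasoning
    D : List (ℚ × Multigraph n)
    D = Gdist 1ℚ H
    K : ℕ
    K = decayConstant L b
    n³ : ℚ
    n³ = fromℕ (n ℕ.^ 3)
    missing : Fin n × Fin n → ℚ
    missing (i , j) = 𝔼 D (notJoined i j)
    union : 𝔼 D (𝟙 ∘ not ∘ Complete) ≤ ∑ (allPairs n) missing
    union = ℚ.≤-trans (𝔼-mono (Gdist-nonNeg H) (λ g → union-bound (λ p → joined g (proj₁ p) (proj₂ p)) (allPairs n)))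
                      (ℚ.≤-reflexive (𝔼-∑ D (allPairs n) (λ p → notJoined (proj₁ p) (proj₂ p))))
    per-pair : ∀ p → p ∈ allPairs n → missing p * n³ ≤ fromℕ K
    per-pair (i , j) ij∈ = let i<j = ∈-allPairs⁻ ij∈ in
      ℚ.≤-trans (ℚ.*-monoʳ-≤-nonNeg n³ {{nonNegative (fromℕ-nonNeg (n ℕ.^ 3))}}
                  (notJoined-≤-missBound^deg L H H≤L i<j))
                (missBound^d*n³≤decayConstant L b (deg H i j) n (n≤deg*b i<j))

uniform⇒pairsIn-≤ : ∀ {n k} {H : Hypergraph n} → Uniform k H → All (λ S → length (pairsIn S) ℕ.≤ k ℕ.* k) H
uniform⇒pairsIn-≤ = All.map (λ {S} ∣S∣≡k → subst (λ m → length (pairsIn S) ℕ.≤ m ℕ.* m) ∣S∣≡k (length-pairsIn S))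

lemma5p2 : (k : ℕ) → k ≥ 3 → (H : (n : ℕ) → Hypergraph n) → (∀ n → Uniform k (H n))
  → (∃ λ c → ∃ λ C → ∃ λ n₀ → (0ℚ <ℚ c) × (0ℚ <ℚ C)
       × (∀ n → n ≥ n₀ → (i j : Fin n) → i < j
            → (c * (+ (n Data.Nat.^ (k ∸ 2)) / 1) ≤ (+ deg (H n) i j / 1))
              × ((+ deg (H n) i j / 1) ≤ C * (+ (n Data.Nat.^ (k ∸ 2)) / 1))))
  → ∀ ε → 0ℚ <ℚ ε → ∃ λ N → ∀ n → n ≥ N → ∣ Prob 1ℚ (H n) Complete - 1ℚ ∣ <ℚ ε
lemma5p2 k k≥3 H uniform (c , _ , n₀ , 0<c , _ , degree-bounds) ε 0<ε
  with b , 1≤cb ← positive⇒∃1≤*fromℕ 0<c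
     | bε , 1≤εbε ← positive⇒∃1≤*fromℕ 0<ε
  = n₀ ℕ.+ suc (K ℕ.* bε) , failure<ε
  where
  K : ℕ
  K = decayConstant (k ℕ.* k) b
  failure<ε : ∀ n → n ≥ n₀ ℕ.+ suc (K ℕ.* bε) → ∣ Prob 1ℚ (H n) Complete - 1ℚ ∣ <ℚ ε
  failure<ε n n≥N = subst (_<ℚ ε) (sym (∣Prob-1∣≡𝔼-not (H n) Complete))
    (x*n³≤n²*K⇒x<ε bε K n 0<ε 1≤εbε (ℕ.m+n≤o⇒n≤o n₀ n≥N)
      (𝔼-incomplete*n³≤n²*decayConstant (k ℕ.* k) b (H n) (uniform⇒pairsIn-≤ (uniform n)) n≤deg*b))
    where
    n≤deg*b : ∀ {i j} → i < j → n ℕ.≤ deg (H n) i j ℕ.* b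
    n≤deg*b {i} {j} i<j = ℕ.≤-trans (n≤n^e n (ℕ.∸-monoˡ-≤ 2 k≥3))
      (1≤c*b∧c*x≤y⇒x≤y*b {c} {b} {n ℕ.^ (k ∸ 2)} {deg (H n) i j} 1≤cb
        (proj₁ (degree-bounds n (ℕ.m+n≤o⇒m≤o n₀ n≥N) i j i<j)))
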